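{- Let $G_2$ be the permutation group on $\{1,\dots,14\}$ generated by $a=(1,3,5,7,9,11,13)(2,4,6,8,10,12,14)$ and $b=(1,12)(2,11)(3,10)(4,9)(5,8)(6,7)(13,14)$. Every non-trivial monotone non-increasing $G_2$-invariant boolean function $f(x_1,\dots,x_{14})$ is elusive.
   Context: Boolean functions of $x_1,\dots,x_n$ are viewed as functions on subsets $\boldsymbol{x}\subseteq\{x_1,\dots,x_n\}$. $f$ is elusive if its deterministic decision tree complexity $D(f)$ (minimum depth of a decision tree querying variables) equals $n$. $f$ is monotone non-increasing if $f(\boldsymbol{x})=1$ implies $f(\boldsymbol{x}')=1$ for all $\boldsymbol{x}'\subseteq\boldsymbol{x}$. A permutation $\sigma$ acts on inputs by $\sigma(\{x_{a_1},\dots,x_{a_m}\})=\{x_{\sigma(a_1)},\dots,x_{\sigma(a_m)}\}$; $f$ is $G$-invariant if $f(\sigma(\boldsymbol{x}))=f(\boldsymbol{x})$ for all $\sigma\in G$ and all $\boldsymbol{x}$. Non-trivial means non-constant. -}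

module Defs where

open import Data.Nat using (ℕ; zero; suc; _⊔_; _≤_)
open import Data.Bool using (Bool; true; false; if_then_else_)
open import Data.Fin using (Fin; #_)
open import Data.Vec using (Vec; []; _∷_; lookup)
open import Data.Product using (∃; ∃-syntax; _×_; _,_)
open import Relation.Binary.PropositionalEquality using (_≡_; _≢_)

-- Inputs: subsets of {x_1,…,x_n}, encoded as characteristic functions
-- (variable x_{k+1} ↔ index k : Fin n).
Input : ℕ → Set
Input n = Fin n → Bool

BoolFun : ℕ → Set
BoolFun n = Input n → Bool

_⊆_ : ∀ {n} → Input n → Input n → Set
x' ⊆ x = ∀ i → x' i ≡ true → x i ≡ true

MonotoneNonIncreasing : ∀ {n} → BoolFun n → Set
MonotoneNonIncreasing f = ∀ x x' → x' ⊆ x → f x ≡ true → f x' ≡ true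

NonTrivial : ∀ {n} → BoolFun n → Set
NonTrivial f = ∃[ x ] ∃[ y ] (f x ≢ f y)

data DecisionTree (n : ℕ) : Set where
  leaf  : Bool → DecisionTree n
  query : Fin n → (ifFalse ifTrue : DecisionTree n) → DecisionTree n

eval : ∀ {n} → DecisionTree n → Input n → Bool
eval (leaf b) x = b
eval (query i t₀ t₁) x = if x i then eval t₁ x else eval t₀ x

depth : ∀ {n} → DecisionTree n → ℕ
depth (leaf _) = zero
depth (query _ t₀ t₁) = suc (depth t₀ ⊔ depth t₁)

Computes : ∀ {n} → DecisionTree n → BoolFun n → Set
Computes t f = ∀ x → eval t x ≡ f x

-- D(f) = n, i.e. every decision tree computing f has depth ≥ n
-- (a tree of depth n querying all variables always exists).
Elusive : ∀ {n} → BoolFun n → Set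
Elusive {n} f = ∀ (t : DecisionTree n) → Computes t f → n ≤ depth t

-- Permutations of {1..14} (0-based indices) given with their inverses.
-- a = (1,3,5,7,9,11,13)(2,4,6,8,10,12,14)  : i ↦ i+2 mod 14 (0-based)
a-tab : Vec (Fin 14) 14
a-tab = # 2 ∷ # 3 ∷ # 4 ∷ # 5 ∷ # 6 ∷ # 7 ∷ # 8 ∷ # 9 ∷ # 10 ∷ # 11 ∷ # 12 ∷ # 13 ∷ # 0 ∷ # 1 ∷ []

a⁻¹-tab : Vec (Fin 14) 14
a⁻¹-tab = # 12 ∷ # 13 ∷ # 0 ∷ # 1 ∷ # 2 ∷ # 3 ∷ # 4 ∷ # 5 ∷ # 6 ∷ # 7 ∷ # 8 ∷ # 9 ∷ # 10 ∷ # 11 ∷ []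

-- b = (1,12)(2,11)(3,10)(4,9)(5,8)(6,7)(13,14), an involution
b-tab : Vec (Fin 14) 14
b-tab = # 11 ∷ # 10 ∷ # 9 ∷ # 8 ∷ # 7 ∷ # 6 ∷ # 5 ∷ # 4 ∷ # 3 ∷ # 2 ∷ # 1 ∷ # 0 ∷ # 13 ∷ # 12 ∷ []

-- Words in the generators a, b and their inverses: these denote exactly
-- the elements of G₂ = ⟨a, b⟩.
data Word : Set where
  ε    : Word
  a·_  : Word → Word
  a⁻¹·_ : Word → Word
  b·_  : Word → Word
  b⁻¹·_ : Word → Word

perm : Word → Fin 14 → Fin 14
perm⁻¹ : Word → Fin 14 → Fin 14
perm ε i = i
perm (a· w) i = lookup a-tab (perm w i)
perm (a⁻¹· w) i = lookup a⁻¹-tab (perm w i)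
perm (b· w) i = lookup b-tab (perm w i)
perm (b⁻¹· w) i = lookup b-tab (perm w i)
perm⁻¹ ε i = i
perm⁻¹ (a· w) i = perm⁻¹ w (lookup a⁻¹-tab i)
perm⁻¹ (a⁻¹· w) i = perm⁻¹ w (lookup a-tab i)
perm⁻¹ (b· w) i = perm⁻¹ w (lookup b-tab i)
perm⁻¹ (b⁻¹· w) i = perm⁻¹ w (lookup b-tab i)

-- σ({x_{a_1},…,x_{a_m}}) = {x_{σ(a_1)},…,x_{σ(a_m)}}: j ∈ σ(x) ⇔ σ⁻¹(j) ∈ x
act : Word → Input 14 → Input 14
act w x j = x (perm⁻¹ w j)

G₂-Invariant : BoolFun 14 → Set
G₂-Invariant f = ∀ (σ : Word) (x : Input 14) → f (act σ x) ≡ f x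

-- For a Boolean function f write χ(f) = Σ_x (-1)^|x| f(x).
--  (1) If a decision tree of depth < n computes f, then χ(f) = 0: every leaf
--      is reached by a subcube of positive dimension, on which the signed sum
--      of a constant vanishes (signed-sum-vanishes).
--  (2) Group the 14 variables into the 7 blocks (x_{2i+1}, x_{2i+2}).  Then a
--      acts as the cyclic rotation of the blocks, and a rotation-invariant
--      weight on block words sums to its values on the constant words plus a
--      multiple of 7, since the other words fall into orbits of size 7
--      (orbit-decomposition).  The orbits are counted through an explicit
--      transversal: a word is selected iff the position-weighted count of a
--      rotation-invariantly chosen letter vanishes mod 7 (constant-or-orbit).
--  (3) Monotone non-trivial f has f(∅) = 1 and f(everything) = 0, and b swaps
--      the two remaining constant words, so they contribute 1 − 2y = ±1.
--      Hence χ(f) = ±1 + 7·D ≠ 0, and by (1) no tree of depth < 14 computes f.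

module Submission where

open import Defs
open import Data.Nat as ℕ using (ℕ; zero; suc; _⊔_; _≤_; _<_; z≤n; s≤s; _∸_; _%_)
open import Data.Nat.DivMod using (%-distribˡ-+; [m+n]%n≡m%n; [m+kn]%n≡m%n; m%n%n≡m%n; m%n<n)
import Data.Nat.Properties as ℕP
open import Data.Nat.GeneralisedArithmetic using (iterate)
import Data.Nat.Tactic.RingSolver as ℕSolver
open import Data.Integer using (ℤ; +_; -_; _+_; _*_; 0ℤ; 1ℤ; -1ℤ; ∣_∣)
import Data.Integer.Properties as ℤP
open import Data.Integer.Tactic.RingSolver using (solve-∀)
open import Data.Bool using (Bool; true; false; if_then_else_)
import Data.Bool.Properties as Boolₚ
open import Data.Maybe using (Maybe; just; nothing; maybe′)
open import Data.Fin using (Fin; zero; suc)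
open import Data.Vec using (Vec; []; _∷_; lookup; replicate; tabulate; _∷ʳ_)
open import Data.Vec.Properties using (lookup∘tabulate; ∷-injectiveʳ)
open import Data.List using (List; []; _∷_)
open import Data.List.Membership.Propositional using (_∈_)
open import Data.List.Relation.Unary.Any using (here; there)
open import Data.Product using (_×_; _,_; proj₁; proj₂; ∃-syntax)
open import Data.Product.Properties using (≡-dec)
open import Data.Sum using (_⊎_; inj₁; inj₂)
open import Data.Empty using (⊥-elim)
open import Data.Unit using (⊤; tt)
open import Relation.Nullary using (¬_; Dec; yes; no; does)
open import Relation.Nullary.Decidable using (toWitness; _×-dec_)
open import Relation.Binary.Definitions using (DecidableEquality)
open import Relation.Binary.PropositionalEquality
open import Algebra.Bundles using (AbelianGroup)
open import Algebra.Properties.Group (AbelianGroup.group ℤP.+-0-abelianGroup) using (inverseʳ-unique)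

sign : ∀ {n} → Vec Bool n → ℤ
sign [] = 1ℤ
sign (false ∷ v) = sign v
sign (true ∷ v) = - sign v

bit : Bool → ℤ
bit true = 1ℤ
bit false = 0ℤ

-- A subcube of {0,1}ⁿ: each coordinate is either fixed (just b) or free.
Cube : ℕ → Set
Cube = Vec (Maybe Bool)

free : ∀ {n} → Cube n → ℕ
free [] = 0
free (nothing ∷ c) = suc (free c)
free (just _ ∷ c) = free c

_∈C_ : ∀ {n} → Vec Bool n → Cube n → Set
[] ∈C [] = ⊤
(x ∷ v) ∈C (nothing ∷ c) = v ∈C c
(x ∷ v) ∈C (just b ∷ c) = (x ≡ b) × (v ∈C c)

sumC : ∀ {n} → Cube n → (Vec Bool n → ℤ) → ℤ
sumC [] g = g []
sumC (nothing ∷ c) g = sumC c (λ v → g (false ∷ v)) + sumC c (λ v → g (true ∷ v))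
sumC (just b ∷ c) g = sumC c (λ v → g (b ∷ v))

sumC-cong : ∀ {n} (c : Cube n) {g h : Vec Bool n → ℤ} →
            (∀ v → v ∈C c → g v ≡ h v) → sumC c g ≡ sumC c h
sumC-cong [] e = e [] tt
sumC-cong (nothing ∷ c) e =
  cong₂ _+_ (sumC-cong c (λ v m → e (false ∷ v) m)) (sumC-cong c (λ v m → e (true ∷ v) m))
sumC-cong (just b ∷ c) e = sumC-cong c (λ v m → e (b ∷ v) (refl , m))

sumC-neg : ∀ {n} (c : Cube n) (g : Vec Bool n → ℤ) → sumC c (λ v → - g v) ≡ - sumC c g
sumC-neg [] g = refl
sumC-neg (nothing ∷ c) g =
  trans (cong₂ _+_ (sumC-neg c _) (sumC-neg c _))
        (sym (ℤP.neg-distrib-+ (sumC c (λ v → g (false ∷ v))) (sumC c (λ v → g (true ∷ v)))))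
sumC-neg (just b ∷ c) g = sumC-neg c _

sumC-sign-true : ∀ {n} (c : Cube n) (k : ℤ) →
                 sumC c (λ v → sign (true ∷ v) * k) ≡ - sumC c (λ v → sign v * k)
sumC-sign-true c k =
  trans (sumC-cong c (λ v _ → sym (ℤP.neg-distribˡ-* (sign v) k))) (sumC-neg c _)

signed-constant : ∀ {n} (c : Cube n) (k : ℤ) → 0 < free c → sumC c (λ v → sign v * k) ≡ 0ℤ
signed-constant (nothing ∷ c) k _ =
  trans (cong (_+_ (sumC c (λ v → sign v * k))) (sumC-sign-true c k))
        (ℤP.+-inverseʳ (sumC c (λ v → sign v * k)))
signed-constant (just false ∷ c) k p = signed-constant c k p
signed-constant (just true ∷ c) k p = trans (sumC-sign-true c k) (cong -_ (signed-constant c k p))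

set : ∀ {n} → Cube n → Fin n → Bool → Cube n
set (_ ∷ c) zero b = just b ∷ c
set (x ∷ c) (suc i) b = x ∷ set c i b

split : ∀ {n} (c : Cube n) i (g : Vec Bool n → ℤ) → lookup c i ≡ nothing →
        sumC c g ≡ sumC (set c i false) g + sumC (set c i true) g
split (nothing ∷ c) zero g e = refl
split (nothing ∷ c) (suc i) g e =
  trans (cong₂ _+_ (split c i _ e) (split c i _ e))
        (interchange (sumC (set c i false) (λ v → g (false ∷ v))) (sumC (set c i true) (λ v → g (false ∷ v)))
                     (sumC (set c i false) (λ v → g (true ∷ v))) (sumC (set c i true) (λ v → g (true ∷ v))))
  where
    interchange : ∀ (a b c d : ℤ) → (a + b) + (c + d) ≡ (a + c) + (b + d)
    interchange = solve-∀
split (just _ ∷ c) (suc i) g e = split c i _ e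

free-set : ∀ {n} (c : Cube n) i b → lookup c i ≡ nothing → free c ≡ suc (free (set c i b))
free-set (nothing ∷ c) zero b e = refl
free-set (nothing ∷ c) (suc i) b e = cong suc (free-set c i b e)
free-set (just _ ∷ c) (suc i) b e = free-set c i b e

∈-set : ∀ {n} (c : Cube n) i b (v : Vec Bool n) → v ∈C set c i b → lookup v i ≡ b
∈-set (_ ∷ c) zero b (y ∷ v) m = proj₁ m
∈-set (nothing ∷ c) (suc i) b (y ∷ v) m = ∈-set c i b v m
∈-set (just _ ∷ c) (suc i) b (y ∷ v) m = ∈-set c i b v (proj₂ m)

∈-fixed : ∀ {n} (c : Cube n) i b (v : Vec Bool n) → v ∈C c → lookup c i ≡ just b → lookup v i ≡ b
∈-fixed (just _ ∷ c) zero b (y ∷ v) m refl = proj₁ m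
∈-fixed (nothing ∷ c) (suc i) b (y ∷ v) m e = ∈-fixed c i b v m e
∈-fixed (just _ ∷ c) (suc i) b (y ∷ v) m e = ∈-fixed c i b v (proj₂ m) e

eval-ext : ∀ {n} (t : DecisionTree n) {x y : Input n} → (∀ i → x i ≡ y i) → eval t x ≡ eval t y
eval-ext (leaf b) same = refl
eval-ext (query i t₀ t₁) same rewrite same i | eval-ext t₀ same | eval-ext t₁ same = refl

signedValue : ∀ {n} → DecisionTree n → Vec Bool n → ℤ
signedValue t v = sign v * bit (eval t (lookup v))

query-on-face : ∀ {n} (c : Cube n) i (t₀ t₁ : DecisionTree n) b →
                (∀ v → v ∈C c → lookup v i ≡ b) →
                sumC c (signedValue (query i t₀ t₁)) ≡ sumC c (signedValue (if b then t₁ else t₀))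
query-on-face c i t₀ t₁ b fixed = sumC-cong c (λ v m → cong (λ z → sign v * bit z) (query-fixed v (fixed v m)))
  where
    query-fixed : ∀ v → lookup v i ≡ b → eval (query i t₀ t₁) (lookup v) ≡ eval (if b then t₁ else t₀) (lookup v)
    query-fixed v refl with lookup v i
    ... | true = refl
    ... | false = refl

signed-sum-vanishes : ∀ {n} (t : DecisionTree n) (c : Cube n) → depth t < free c →
                      sumC c (signedValue t) ≡ 0ℤ
signed-sum-vanishes (leaf b) c d = signed-constant c (bit b) d
signed-sum-vanishes (query i t₀ t₁) c d with lookup c i in e
... | just false =
  trans (query-on-face c i t₀ t₁ false (λ v m → ∈-fixed c i false v m e))
        (signed-sum-vanishes t₀ c (ℕP.<-trans (s≤s (ℕP.m≤m⊔n (depth t₀) (depth t₁))) d))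
... | just true =
  trans (query-on-face c i t₀ t₁ true (λ v m → ∈-fixed c i true v m e))
        (signed-sum-vanishes t₁ c (ℕP.<-trans (s≤s (ℕP.m≤n⊔m (depth t₀) (depth t₁))) d))
... | nothing =
  trans (split c i _ e)
        (cong₂ _+_ (half false (signed-sum-vanishes t₀ (set c i false) (ℕP.≤-<-trans (ℕP.m≤m⊔n _ _) (shrink false))))
                   (half true (signed-sum-vanishes t₁ (set c i true) (ℕP.≤-<-trans (ℕP.m≤n⊔m _ _) (shrink true)))))
  where
    shrink : ∀ b → depth t₀ ⊔ depth t₁ < free (set c i b)
    shrink b = ℕ.s≤s⁻¹ (subst (depth (query i t₀ t₁) <_) (free-set c i b e) d)
    half : ∀ b → sumC (set c i b) (signedValue (if b then t₁ else t₀)) ≡ 0ℤ →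
           sumC (set c i b) (signedValue (query i t₀ t₁)) ≡ 0ℤ
    half b = trans (query-on-face (set c i b) i t₀ t₁ b (∈-set c i b))

Block : Set
Block = Bool × Bool

_≟B_ : DecidableEquality Block
_≟B_ = ≡-dec Boolₚ._≟_ Boolₚ._≟_

sumBlock : (Block → ℤ) → ℤ
sumBlock g = (g (false , false) + g (false , true)) + (g (true , false) + g (true , true))

sumBlocks : ∀ n → (Vec Block n → ℤ) → ℤ
sumBlocks zero g = g []
sumBlocks (suc n) g = sumBlock (λ β → sumBlocks n (λ w → g (β ∷ w)))

flatten : ∀ {n} → Vec Block n → Vec Bool (n ℕ.* 2)
flatten [] = []
flatten ((p , q) ∷ w) = p ∷ q ∷ flatten w

input : ∀ {n} → Vec Block n → Input (n ℕ.* 2)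
input v = lookup (flatten v)

full-cube-by-blocks : ∀ n (g : Vec Bool (n ℕ.* 2) → ℤ) →
                      sumC (replicate (n ℕ.* 2) nothing) g ≡ sumBlocks n (λ v → g (flatten v))
full-cube-by-blocks zero g = refl
full-cube-by-blocks (suc n) g =
  cong₂ _+_ (cong₂ _+_ (full-cube-by-blocks n _) (full-cube-by-blocks n _))
            (cong₂ _+_ (full-cube-by-blocks n _) (full-cube-by-blocks n _))

free-full : ∀ m → free {m} (replicate m nothing) ≡ m
free-full zero = refl
free-full (suc m) = cong suc (free-full m)

shallow-tree-sum : ∀ n (t : DecisionTree (n ℕ.* 2)) → depth t < n ℕ.* 2 →
                   sumBlocks n (λ v → signedValue t (flatten v)) ≡ 0ℤ
shallow-tree-sum n t d =
  trans (sym (full-cube-by-blocks n (signedValue t)))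
        (signed-sum-vanishes t (replicate (n ℕ.* 2) nothing) (subst (depth t <_) (sym (free-full (n ℕ.* 2))) d))

sumBlock-cong : ∀ {g h : Block → ℤ} → (∀ β → g β ≡ h β) → sumBlock g ≡ sumBlock h
sumBlock-cong e = cong₂ _+_ (cong₂ _+_ (e _) (e _)) (cong₂ _+_ (e _) (e _))

sumBlocks-cong : ∀ n {g h : Vec Block n → ℤ} → (∀ v → g v ≡ h v) → sumBlocks n g ≡ sumBlocks n h
sumBlocks-cong zero e = e []
sumBlocks-cong (suc n) e = sumBlock-cong (λ β → sumBlocks-cong n (λ w → e (β ∷ w)))

sumBlock-+ : ∀ (g h : Block → ℤ) → sumBlock (λ β → g β + h β) ≡ sumBlock g + sumBlock h
sumBlock-+ g h = regroup (g (false , false)) (g (false , true)) (g (true , false)) (g (true , true))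
                         (h (false , false)) (h (false , true)) (h (true , false)) (h (true , true))
  where
    regroup : ∀ (a b c d a' b' c' d' : ℤ) →
              ((a + a') + (b + b')) + ((c + c') + (d + d')) ≡ ((a + b) + (c + d)) + ((a' + b') + (c' + d'))
    regroup = solve-∀

sumBlocks-+ : ∀ n (g h : Vec Block n → ℤ) → sumBlocks n (λ v → g v + h v) ≡ sumBlocks n g + sumBlocks n h
sumBlocks-+ zero g h = refl
sumBlocks-+ (suc n) g h =
  trans (sumBlock-cong (λ β → sumBlocks-+ n (λ w → g (β ∷ w)) (λ w → h (β ∷ w))))
        (sumBlock-+ (λ β → sumBlocks n (λ w → g (β ∷ w))) (λ β → sumBlocks n (λ w → h (β ∷ w))))

sumBlocks-zero : ∀ n (g : Vec Block n → ℤ) → sumBlocks n (λ v → g v * 0ℤ) ≡ 0ℤ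
sumBlocks-zero zero g = ℤP.*-zeroʳ (g [])
sumBlocks-zero (suc n) g = sumBlock-cong (λ β → sumBlocks-zero n (λ w → g (β ∷ w)))

sumBlock-sumBlocks : ∀ n (h : Block → Vec Block n → ℤ) →
                     sumBlock (λ β → sumBlocks n (h β)) ≡ sumBlocks n (λ w → sumBlock (λ β → h β w))
sumBlock-sumBlocks n h = sym (begin
  sumBlocks n (λ w → sumBlock (λ β → h β w))
    ≡⟨ sumBlocks-+ n (λ w → h (false , false) w + h (false , true) w) (λ w → h (true , false) w + h (true , true) w) ⟩
  sumBlocks n (λ w → h (false , false) w + h (false , true) w) + sumBlocks n (λ w → h (true , false) w + h (true , true) w)
    ≡⟨ cong₂ _+_ (sumBlocks-+ n (h (false , false)) (h (false , true))) (sumBlocks-+ n (h (true , false)) (h (true , true))) ⟩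
  sumBlock (λ β → sumBlocks n (h β)) ∎)
  where open ≡-Reasoning

sumBlocks-snoc : ∀ n (g : Vec Block (suc n) → ℤ) → sumBlocks (suc n) g ≡ sumBlocks n (λ w → sumBlock (λ β → g (w ∷ʳ β)))
sumBlocks-snoc zero g = refl
sumBlocks-snoc (suc n) g = sumBlock-cong (λ β → sumBlocks-snoc n (λ w → g (β ∷ w)))

rotate : ∀ {n} → Vec Block (suc n) → Vec Block (suc n)
rotate (β ∷ w) = w ∷ʳ β

sumBlocks-rotate : ∀ n (g : Vec Block (suc n) → ℤ) → sumBlocks (suc n) (λ v → g (rotate v)) ≡ sumBlocks (suc n) g
sumBlocks-rotate n g = trans (sumBlock-sumBlocks n (λ β w → g (w ∷ʳ β))) (sym (sumBlocks-snoc n g))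

sign-snoc : ∀ {n} (u : Vec Bool n) b → sign (u ∷ʳ b) ≡ sign (b ∷ u)
sign-snoc [] b = refl
sign-snoc (false ∷ u) false = sign-snoc u false
sign-snoc (false ∷ u) true = sign-snoc u true
sign-snoc (true ∷ u) false = cong -_ (sign-snoc u false)
sign-snoc (true ∷ u) true = cong -_ (sign-snoc u true)

sign-cons : ∀ {n} b {u u' : Vec Bool n} → sign u ≡ sign u' → sign (b ∷ u) ≡ sign (b ∷ u')
sign-cons false e = e
sign-cons true e = cong -_ e

flatten-snoc : ∀ {n} (w : Vec Block n) p q → flatten (w ∷ʳ (p , q)) ≡ (flatten w ∷ʳ p) ∷ʳ q
flatten-snoc [] p q = refl
flatten-snoc ((p' , q') ∷ w) p q = cong (λ u → p' ∷ q' ∷ u) (flatten-snoc w p q)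

sign-rotate : ∀ {n} (v : Vec Block (suc n)) → sign (flatten (rotate v)) ≡ sign (flatten v)
sign-rotate ((p , q) ∷ w) = begin
  sign (flatten (w ∷ʳ (p , q)))    ≡⟨ cong sign (flatten-snoc w p q) ⟩
  sign ((flatten w ∷ʳ p) ∷ʳ q)     ≡⟨ sign-snoc (flatten w ∷ʳ p) q ⟩
  sign (q ∷ (flatten w ∷ʳ p))      ≡⟨ sign-cons q (sign-snoc (flatten w) p) ⟩
  sign (q ∷ p ∷ flatten w)         ≡⟨ swap p q ⟩
  sign (p ∷ q ∷ flatten w)         ∎
  where
    open ≡-Reasoning
    swap : ∀ p q {m} {u : Vec Bool m} → sign (q ∷ p ∷ u) ≡ sign (p ∷ q ∷ u)
    swap false false = refl
    swap false true = refl
    swap true false = refl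
    swap true true = refl

sumUpTo : ℕ → (ℕ → ℤ) → ℤ
sumUpTo zero g = 0ℤ
sumUpTo (suc K) g = g 0 + sumUpTo K (λ k → g (suc k))

sumUpTo-cong : ∀ K {g h : ℕ → ℤ} → (∀ k → g k ≡ h k) → sumUpTo K g ≡ sumUpTo K h
sumUpTo-cong zero e = refl
sumUpTo-cong (suc K) e = cong₂ _+_ (e 0) (sumUpTo-cong K (λ k → e (suc k)))

sumUpTo-const : ∀ K (D : ℤ) → sumUpTo K (λ _ → D) ≡ + K * D
sumUpTo-const zero D = sym (ℤP.*-zeroˡ D)
sumUpTo-const (suc K) D = begin
  D + sumUpTo K (λ _ → D) ≡⟨ cong (_+_ D) (sumUpTo-const K D) ⟩
  D + + K * D             ≡⟨ cong (λ z → z + + K * D) (sym (ℤP.*-identityˡ D)) ⟩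
  1ℤ * D + + K * D        ≡⟨ sym (ℤP.*-distribʳ-+ D 1ℤ (+ K)) ⟩
  + suc K * D             ∎
  where open ≡-Reasoning

*-sumUpTo : ∀ K (a : ℤ) (g : ℕ → ℤ) → a * sumUpTo K g ≡ sumUpTo K (λ k → a * g k)
*-sumUpTo zero a g = ℤP.*-zeroʳ a
*-sumUpTo (suc K) a g = trans (ℤP.*-distribˡ-+ a (g 0) _) (cong (_+_ (a * g 0)) (*-sumUpTo K a (λ k → g (suc k))))

sumBlocks-sumUpTo : ∀ n K (h : ℕ → Vec Block n → ℤ) →
                    sumBlocks n (λ v → sumUpTo K (λ k → h k v)) ≡ sumUpTo K (λ k → sumBlocks n (h k))
sumBlocks-sumUpTo n zero h = trans (sumBlocks-cong n (λ _ → sym (ℤP.*-zeroʳ 0ℤ))) (sumBlocks-zero n (λ _ → 0ℤ))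
sumBlocks-sumUpTo n (suc K) h =
  trans (sumBlocks-+ n (h 0) (λ v → sumUpTo K (λ k → h (suc k) v)))
        (cong (_+_ (sumBlocks n (h 0))) (sumBlocks-sumUpTo n K (λ k → h (suc k))))

agrees : ∀ {n} → Block → Vec Block n → ℤ
agrees x [] = 1ℤ
agrees x (y ∷ w) = if does (y ≟B x) then agrees x w else 0ℤ

isConstant : ∀ {n} → Vec Block (suc n) → ℤ
isConstant (x ∷ w) = agrees x w

agrees-cases : ∀ {n} x (w : Vec Block n) → agrees x w ≡ 0ℤ ⊎ w ≡ replicate n x
agrees-cases x [] = inj₂ refl
agrees-cases x (y ∷ w) with y ≟B x
... | no _ = inj₁ refl
... | yes refl with agrees-cases x w
...   | inj₁ z = inj₁ z
...   | inj₂ w≡ = inj₂ (cong (x ∷_) w≡)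

agrees-replicate : ∀ n x → agrees x (replicate n x) ≡ 1ℤ
agrees-replicate zero x = refl
agrees-replicate (suc n) x with x ≟B x
... | yes _ = agrees-replicate n x
... | no x≢x = ⊥-elim (x≢x refl)

sumBlock-select : ∀ x (h : Block → ℤ) → sumBlock (λ y → if does (y ≟B x) then h y else 0ℤ) ≡ h x
sumBlock-select (false , false) h = trans (ℤP.+-identityʳ _) (ℤP.+-identityʳ _)
sumBlock-select (false , true) h = trans (ℤP.+-identityʳ _) (ℤP.+-identityˡ _)
sumBlock-select (true , false) h = trans (ℤP.+-identityˡ _) (ℤP.+-identityʳ _)
sumBlock-select (true , true) h = trans (ℤP.+-identityˡ _) (ℤP.+-identityˡ _)

sum-agrees : ∀ n x (G : Vec Block n → ℤ) → sumBlocks n (λ w → G w * agrees x w) ≡ G (replicate n x)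
sum-agrees zero x G = ℤP.*-identityʳ (G [])
sum-agrees (suc n) x G =
  trans (sumBlock-cong (λ y → guarded (does (y ≟B x)) (λ w → G (y ∷ w))))
        (trans (sumBlock-select x (λ y → sumBlocks n (λ w → G (y ∷ w) * agrees x w))) (sum-agrees n x (λ w → G (x ∷ w))))
  where
    guarded : ∀ b (H : Vec Block n → ℤ) →
              sumBlocks n (λ w → H w * (if b then agrees x w else 0ℤ)) ≡ (if b then sumBlocks n (λ w → H w * agrees x w) else 0ℤ)
    guarded true H = refl
    guarded false H = sumBlocks-zero n H

sum-along-rotations : ∀ n (g h : Vec Block (suc n) → ℤ) → (∀ v → g (rotate v) ≡ g v) → ∀ k →
                      sumBlocks (suc n) (λ v → g v * h (iterate rotate v k)) ≡ sumBlocks (suc n) (λ v → g v * h v)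
sum-along-rotations n g h invariant zero = refl
sum-along-rotations n g h invariant (suc k) =
  trans (sumBlocks-cong (suc n) (λ v → cong (_* h (iterate rotate (rotate v) k)) (sym (invariant v))))
        (trans (sumBlocks-rotate n (λ u → g u * h (iterate rotate u k)))
               (sum-along-rotations n g h invariant k))

orbit-decomposition : ∀ n K (T : Vec Block (suc n) → ℤ) →
                      (∀ v → isConstant v + sumUpTo K (λ k → T (iterate rotate v k)) ≡ 1ℤ) →
                      (g : Vec Block (suc n) → ℤ) → (∀ v → g (rotate v) ≡ g v) →
                      sumBlocks (suc n) g ≡ sumBlock (λ β → g (replicate (suc n) β)) + + K * sumBlocks (suc n) (λ v → g v * T v)
orbit-decomposition n K T partition g invariant = begin
  sumBlocks (suc n) g
    ≡⟨ sumBlocks-cong (suc n) (λ v → trans (sym (ℤP.*-identityʳ (g v))) (cong (g v *_) (sym (partition v)))) ⟩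
  sumBlocks (suc n) (λ v → g v * (isConstant v + orbitSum v))
    ≡⟨ sumBlocks-cong (suc n) (λ v → ℤP.*-distribˡ-+ (g v) (isConstant v) (orbitSum v)) ⟩
  sumBlocks (suc n) (λ v → g v * isConstant v + g v * orbitSum v)
    ≡⟨ sumBlocks-+ (suc n) (λ v → g v * isConstant v) (λ v → g v * orbitSum v) ⟩
  sumBlocks (suc n) (λ v → g v * isConstant v) + sumBlocks (suc n) (λ v → g v * orbitSum v)
    ≡⟨ cong₂ _+_ (sumBlock-cong (λ x → sum-agrees n x (λ w → g (x ∷ w)))) orbits ⟩
  sumBlock (λ β → g (replicate (suc n) β)) + + K * D ∎
  where
    open ≡-Reasoning
    orbitSum : Vec Block (suc n) → ℤ
    orbitSum v = sumUpTo K (λ k → T (iterate rotate v k))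
    D : ℤ
    D = sumBlocks (suc n) (λ v → g v * T v)
    orbits : sumBlocks (suc n) (λ v → g v * orbitSum v) ≡ + K * D
    orbits = begin
      sumBlocks (suc n) (λ v → g v * orbitSum v)
        ≡⟨ sumBlocks-cong (suc n) (λ v → *-sumUpTo K (g v) (λ k → T (iterate rotate v k))) ⟩
      sumBlocks (suc n) (λ v → sumUpTo K (λ k → g v * T (iterate rotate v k)))
        ≡⟨ sumBlocks-sumUpTo (suc n) K (λ k v → g v * T (iterate rotate v k)) ⟩
      sumUpTo K (λ k → sumBlocks (suc n) (λ v → g v * T (iterate rotate v k)))
        ≡⟨ sumUpTo-cong K (sum-along-rotations n g T invariant) ⟩
      sumUpTo K (λ _ → D)
        ≡⟨ sumUpTo-const K D ⟩
      + K * D ∎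

δ : Block → Block → ℕ
δ x β = if does (x ≟B β) then 1 else 0

δ-cases : ∀ x β → (x ≡ β × δ x β ≡ 1) ⊎ δ x β ≡ 0
δ-cases x β with x ≟B β
... | yes x≡β = inj₁ (x≡β , refl)
... | no _ = inj₂ refl

δ-refl : ∀ x → δ x x ≡ 1
δ-refl x with x ≟B x
... | yes _ = refl
... | no x≢x = ⊥-elim (x≢x refl)

count : ∀ {n} → Block → Vec Block n → ℕ
count β [] = 0
count β (x ∷ w) = δ x β ℕ.+ count β w

-- Σ_i i·[v_i = β] (positions counted from 0)
weight : ∀ {n} → Block → Vec Block n → ℕ
weight β [] = 0
weight β (x ∷ w) = weight β w ℕ.+ count β w

count-≤ : ∀ {n} β (v : Vec Block n) → count β v ≤ n
count-≤ β [] = z≤n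
count-≤ β (x ∷ w) with δ-cases x β
... | inj₁ (_ , d≡1) rewrite d≡1 = s≤s (count-≤ β w)
... | inj₂ d≡0 rewrite d≡0 = ℕP.m≤n⇒m≤1+n (count-≤ β w)

count-full : ∀ {n} β (v : Vec Block n) → count β v ≡ n → v ≡ replicate n β
count-full β [] e = refl
count-full {suc n} β (x ∷ w) e with δ-cases x β
... | inj₁ (x≡β , d≡1) rewrite d≡1 = cong₂ _∷_ x≡β (count-full β w (ℕP.suc-injective e))
... | inj₂ d≡0 rewrite d≡0 = ⊥-elim (ℕP.<-irrefl refl (subst (_≤ n) e (count-≤ β w)))

count-replicate : ∀ n β x → count β (replicate n x) ≡ n ℕ.* δ x β
count-replicate zero β x = refl
count-replicate (suc n) β x = cong (δ x β ℕ.+_) (count-replicate n β x)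

count-snoc : ∀ {n} β (w : Vec Block n) x → count β (w ∷ʳ x) ≡ count β w ℕ.+ δ x β
count-snoc β [] x = ℕP.+-identityʳ (δ x β)
count-snoc β (y ∷ w) x =
  trans (cong (δ y β ℕ.+_) (count-snoc β w x)) (sym (ℕP.+-assoc (δ y β) (count β w) (δ x β)))

weight-snoc : ∀ {n} β (w : Vec Block n) x → weight β (w ∷ʳ x) ≡ weight β w ℕ.+ n ℕ.* δ x β
weight-snoc β [] x = refl
weight-snoc {suc n} β (y ∷ w) x rewrite weight-snoc β w x | count-snoc β w x =
  regroup (weight β w) (count β w) n (δ x β)
  where
    regroup : ∀ a b c d → (a ℕ.+ c ℕ.* d) ℕ.+ (b ℕ.+ d) ≡ (a ℕ.+ b) ℕ.+ (d ℕ.+ c ℕ.* d)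
    regroup = ℕSolver.solve-∀

count-rotate : ∀ {n} β (v : Vec Block (suc n)) → count β (rotate v) ≡ count β v
count-rotate β (x ∷ w) = trans (count-snoc β w x) (ℕP.+-comm (count β w) (δ x β))

count-iterate : ∀ {n} β (v : Vec Block (suc n)) k → count β (iterate rotate v k) ≡ count β v
count-iterate β v zero = refl
count-iterate β v (suc k) = trans (count-iterate β (rotate v) k) (count-rotate β v)

-- Rotation moves every occurrence of β one place to the left (cyclically):
-- weight(rotate v) + count v ≡ weight v  modulo the length.
weight-rotate : ∀ {n} β (v : Vec Block (suc n)) →
                (weight β (rotate v) ℕ.+ count β v) % suc n ≡ weight β v % suc n
weight-rotate {n} β (x ∷ w) = begin
  (weight β (w ∷ʳ x) ℕ.+ (δ x β ℕ.+ count β w)) % suc n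
    ≡⟨ cong (λ z → (z ℕ.+ (δ x β ℕ.+ count β w)) % suc n) (weight-snoc β w x) ⟩
  ((weight β w ℕ.+ n ℕ.* δ x β) ℕ.+ (δ x β ℕ.+ count β w)) % suc n
    ≡⟨ cong (_% suc n) (regroup (weight β w) (count β w) n (δ x β)) ⟩
  (weight β (x ∷ w) ℕ.+ δ x β ℕ.* suc n) % suc n
    ≡⟨ [m+kn]%n≡m%n (weight β (x ∷ w)) (δ x β) (suc n) ⟩
  weight β (x ∷ w) % suc n ∎
  where
    open ≡-Reasoning
    regroup : ∀ a b c d → (a ℕ.+ c ℕ.* d) ℕ.+ (d ℕ.+ b) ≡ (a ℕ.+ b) ℕ.+ d ℕ.* suc c
    regroup = ℕSolver.solve-∀

step : (m c : ℕ) .{{_ : ℕ.NonZero m}} → ℕ → ℕ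
step m c r = (r ℕ.+ (m ∸ c)) % m

mod-shift : ∀ m .{{_ : ℕ.NonZero m}} X Y c → c ≤ m → (X ℕ.+ c) % m ≡ Y % m → X % m ≡ step m c (Y % m)
mod-shift m X Y c c≤m e = begin
  X % m                                   ≡⟨ sym ([m+n]%n≡m%n X m) ⟩
  (X ℕ.+ m) % m                           ≡⟨ cong (λ z → (X ℕ.+ z) % m) (sym (ℕP.m+[n∸m]≡n c≤m)) ⟩
  (X ℕ.+ (c ℕ.+ (m ∸ c))) % m             ≡⟨ cong (_% m) (sym (ℕP.+-assoc X c (m ∸ c))) ⟩
  ((X ℕ.+ c) ℕ.+ (m ∸ c)) % m             ≡⟨ %-distribˡ-+ (X ℕ.+ c) (m ∸ c) m ⟩
  ((X ℕ.+ c) % m ℕ.+ (m ∸ c) % m) % m     ≡⟨ cong (λ z → (z ℕ.+ (m ∸ c) % m) % m) (trans e (sym (m%n%n≡m%n Y m))) ⟩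
  (Y % m % m ℕ.+ (m ∸ c) % m) % m         ≡⟨ sym (%-distribˡ-+ (Y % m) (m ∸ c) m) ⟩
  step m c (Y % m)                        ∎
  where open ≡-Reasoning

weight-iterate : ∀ {n} β (v : Vec Block (suc n)) k →
                 weight β (iterate rotate v k) % suc n ≡ iterate (step (suc n) (count β v)) (weight β v % suc n) k
weight-iterate β v zero = refl
weight-iterate {n} β v (suc k) =
  trans (weight-iterate β (rotate v) k)
        (cong₂ (λ c r → iterate (step (suc n) c) r k) (count-rotate β v)
               (mod-shift (suc n) (weight β (rotate v)) (weight β v) (count β v) (count-≤ β v) (weight-rotate β v)))

isZero : ℕ → ℤ
isZero zero = 1ℤ
isZero (suc _) = 0ℤ

-- A count that can occur in a non-constant word of length 7.
Proper : ℕ → Set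
Proper c = 1 ≤ c × c ≤ 6

-- Since 7 is prime, for 1 ≤ c ≤ 6 subtracting c modulo 7 is a 7-cycle, so
-- exactly one of the first seven iterates starting at r < 7 is 0.
-- (A finite check of 42 cases, discharged by the decision procedure.)
step-hits-zero-once : ∀ {r} → r < 7 → ∀ {c} → Proper c → sumUpTo 7 (λ k → isZero (iterate (step 7 c) r k)) ≡ 1ℤ
step-hits-zero-once r<7 {zero} (() , _)
step-hits-zero-once r<7 {suc c} (_ , c<6) = table r<7 c<6
  where
    table : ∀ {r} → r < 7 → ∀ {c} → c < 6 → sumUpTo 7 (λ k → isZero (iterate (step 7 (suc c)) r k)) ≡ 1ℤ
    table = toWitness {a? = ℕP.allUpTo? (λ r → ℕP.allUpTo? (λ c →
                              sumUpTo 7 (λ k → isZero (iterate (step 7 (suc c)) r k)) ℤP.≟ 1ℤ) 6) 7} tt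

improper-count : ∀ {c} → 1 ≤ c → c ≤ 7 → ¬ Proper c → c ≡ 7
improper-count {c} 1≤c c≤7 ¬proper with c ℕ.≤? 6
... | yes c≤6 = ⊥-elim (¬proper (1≤c , c≤6))
... | no c≰6 = ℕP.≤-antisym c≤7 (ℕP.≰⇒> c≰6)

letters : List Block
letters = (false , false) ∷ (false , true) ∷ (true , false) ∷ (true , true) ∷ []

every-letter : ∀ β → β ∈ letters
every-letter (false , false) = here refl
every-letter (false , true) = there (here refl)
every-letter (true , false) = there (there (here refl))
every-letter (true , true) = there (there (there (here refl)))

proper? : ∀ c → Dec (Proper c)
proper? c = 1 ℕ.≤? c ×-dec c ℕ.≤? 6

firstProper : (Block → ℕ) → List Block → Maybe Block
firstProper κ [] = nothing
firstProper κ (β ∷ βs) with proper? (κ β)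
... | yes _ = just β
... | no _ = firstProper κ βs

firstProper-cong : ∀ {κ κ'} → (∀ β → κ β ≡ κ' β) → ∀ βs → firstProper κ βs ≡ firstProper κ' βs
firstProper-cong e [] = refl
firstProper-cong {κ} {κ'} e (β ∷ βs) with proper? (κ β) | proper? (κ' β)
... | yes _ | yes _ = refl
... | no _ | no _ = firstProper-cong e βs
... | yes p | no ¬p = ⊥-elim (¬p (subst Proper (e β) p))
... | no ¬p | yes p = ⊥-elim (¬p (subst Proper (sym (e β)) p))

firstProper-sound : ∀ κ βs {β} → firstProper κ βs ≡ just β → Proper (κ β)
firstProper-sound κ (β' ∷ βs) e with proper? (κ β')
firstProper-sound κ (β' ∷ βs) refl | yes proper = proper
... | no _ = firstProper-sound κ βs e

firstProper-complete : ∀ κ βs {β} → firstProper κ βs ≡ nothing → β ∈ βs → ¬ Proper (κ β)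
firstProper-complete κ (β' ∷ βs) e m with proper? (κ β') | m
firstProper-complete κ (β' ∷ βs) () m | yes _ | _
... | no improper | here refl = improper
... | no _ | there m' = firstProper-complete κ βs e m'

pick : Vec Block 7 → Maybe Block
pick v = firstProper (λ β → count β v) letters

pick-iterate : ∀ v k → pick (iterate rotate v k) ≡ pick v
pick-iterate v k = firstProper-cong (λ β → count-iterate β v k) letters

selectedBy : Block → Vec Block 7 → ℤ
selectedBy β v = isZero (weight β v % 7)

-- The transversal: in every orbit of size 7 exactly one word is selected.
transversal : Vec Block 7 → ℤ
transversal v = maybe′ (λ β → selectedBy β v) 0ℤ (pick v)

constant-not-proper : ∀ β x → ¬ Proper (count β (replicate 7 x))
constant-not-proper β x (1≤c , c≤6) with δ-cases x β
... | inj₁ (_ , d≡1) = ℕP.<-irrefl refl (subst (_≤ 6) (trans (count-replicate 7 β x) (cong (7 ℕ.*_) d≡1)) c≤6)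
... | inj₂ d≡0 = ℕP.<-irrefl refl (subst (1 ≤_) (trans (count-replicate 7 β x) (cong (7 ℕ.*_) d≡0)) 1≤c)

orbit-selected-once : ∀ v {β} → pick v ≡ just β →
                      isConstant v ≡ 0ℤ × sumUpTo 7 (λ k → transversal (iterate rotate v k)) ≡ 1ℤ
orbit-selected-once (x ∷ w) {β} e = not-constant , selected-once
  where
    proper : Proper (count β (x ∷ w))
    proper = firstProper-sound (λ β → count β (x ∷ w)) letters e
    not-constant : agrees x w ≡ 0ℤ
    not-constant with agrees-cases x w
    ... | inj₁ z = z
    ... | inj₂ refl = ⊥-elim (constant-not-proper β x proper)
    selected-once : sumUpTo 7 (λ k → transversal (iterate rotate (x ∷ w) k)) ≡ 1ℤ
    selected-once =
      trans (sumUpTo-cong 7 (λ k → trans (cong (maybe′ (λ β → selectedBy β (iterate rotate (x ∷ w) k)) 0ℤ)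
                                                  (trans (pick-iterate (x ∷ w) k) e))
                                           (cong isZero (weight-iterate β (x ∷ w) k))))
            (step-hits-zero-once (m%n<n (weight β (x ∷ w)) 7) proper)

constant-unselected : ∀ v → pick v ≡ nothing →
                      isConstant v ≡ 1ℤ × sumUpTo 7 (λ k → transversal (iterate rotate v k)) ≡ 0ℤ
constant-unselected (x ∷ w) e =
  constant , sumUpTo-cong 7 (λ k → cong (maybe′ (λ β → selectedBy β (iterate rotate (x ∷ w) k)) 0ℤ)
                                        (trans (pick-iterate (x ∷ w) k) e))
  where
    occurs : 1 ≤ count x (x ∷ w)
    occurs = subst (λ d → 1 ≤ d ℕ.+ count x w) (sym (δ-refl x)) (s≤s z≤n)
    everywhere : count x (x ∷ w) ≡ 7
    everywhere = improper-count occurs (count-≤ x (x ∷ w)) (firstProper-complete (λ β → count β (x ∷ w)) letters e (every-letter x))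
    constant : agrees x w ≡ 1ℤ
    constant = trans (cong (agrees x) (∷-injectiveʳ (count-full x (x ∷ w) everywhere))) (agrees-replicate 6 x)

constant-or-orbit : ∀ v → isConstant v + sumUpTo 7 (λ k → transversal (iterate rotate v k)) ≡ 1ℤ
constant-or-orbit v = by-pick (pick v) refl
  where
    by-pick : ∀ m → pick v ≡ m → isConstant v + sumUpTo 7 (λ k → transversal (iterate rotate v k)) ≡ 1ℤ
    by-pick (just β) e = let (c , s) = orbit-selected-once v e in cong₂ _+_ c s
    by-pick nothing e = let (c , s) = constant-unselected v e in cong₂ _+_ c s

-- Functions on Fin n agree pointwise when their tabulations agree; for
-- concrete n this lets Agda check a pointwise identity by computation.
pointwise : ∀ {n} {A : Set} {g h : Fin n → A} → tabulate g ≡ tabulate h → ∀ j → g j ≡ h j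
pointwise {g = g} {h} e j = trans (sym (lookup∘tabulate g j)) (trans (cong (λ u → lookup u j) e) (lookup∘tabulate h j))

-- a⁻¹ shifts indices by −2, i.e. it rotates the blocks.
a⁻¹-rotates : ∀ (v : Vec Block 7) j → input (rotate v) j ≡ act (a⁻¹· ε) (input v) j
a⁻¹-rotates (β₀ ∷ β₁ ∷ β₂ ∷ β₃ ∷ β₄ ∷ β₅ ∷ β₆ ∷ []) = pointwise refl

-- b exchanges the two coordinates of every block (and reverses their order).
b-swaps : ∀ j → input (replicate 7 (true , false)) j ≡ act (b· ε) (input (replicate 7 (false , true))) j
b-swaps = pointwise refl

takes-value : ∀ {n} (f : BoolFun n) → NonTrivial f → ∀ b → ∃[ z ] f z ≡ b
takes-value f (x , y , fx≢fy) b with f x in ex | f y in ey | b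
... | true | _ | true = x , ex
... | false | true | true = y , ey
... | false | _ | false = x , ex
... | true | false | false = y , ey
... | false | false | true = ⊥-elim (fx≢fy refl)
... | true | true | false = ⊥-elim (fx≢fy refl)

-- f(∅) = 1: the empty set lies below a set where f is 1.
empty-true : ∀ {n} (f : BoolFun n) → NonTrivial f → MonotoneNonIncreasing f → f (λ _ → false) ≡ true
empty-true f nontrivial monotone =
  let (z , fz) = takes-value f nontrivial true in monotone z (λ _ → false) (λ _ ()) fz

-- f(everything) = 0: otherwise f would be 1 on every set, all sets lying below it.
full-false : ∀ {n} (f : BoolFun n) → NonTrivial f → MonotoneNonIncreasing f → f (λ _ → true) ≡ false
full-false f nontrivial monotone with f (λ _ → true) in e
... | false = refl
... | true = let (z , fz) = takes-value f nontrivial false in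
             ⊥-elim (Boolₚ.not-¬ (monotone (λ _ → true) z (λ _ _ → refl) e) fz)

unit-plus-seven : ∀ X D → ∣ X ∣ ≡ 1 → X + + 7 * D ≢ 0ℤ
unit-plus-seven X D unit e = seven-∤-one ∣ D ∣ (begin
  7 ℕ.* ∣ D ∣  ≡⟨ sym (ℤP.abs-* (+ 7) D) ⟩
  ∣ + 7 * D ∣  ≡⟨ cong ∣_∣ (inverseʳ-unique X (+ 7 * D) e) ⟩
  ∣ - X ∣      ≡⟨ ℤP.∣-i∣≡∣i∣ X ⟩
  ∣ X ∣        ≡⟨ unit ⟩
  1            ∎)
  where
    open ≡-Reasoning
    seven-∤-one : ∀ m → 7 ℕ.* m ≢ 1
    seven-∤-one zero ()
    seven-∤-one (suc m) e with trans (ℕP.*-comm (suc m) 7) e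
    ... | ()

-- The contribution Σ_β sign(β⁷)·f(β⁷) of the four constant words when
-- f(∅) = 1, f(everything) = 0 and both mixed constant words have value y.
constant-words : Bool → ℤ
constant-words y = (1ℤ * bit true + -1ℤ * bit y) + (-1ℤ * bit y + 1ℤ * bit false)

constant-words-unit : ∀ y → ∣ constant-words y ∣ ≡ 1
constant-words-unit true = refl
constant-words-unit false = refl

-- (3) No tree of depth < 14 computes a G₂-invariant f with f(∅) = 1 and
-- f(everything) = 0: its signed sum would be both 0 and ±1 + 7·D.
no-shallow-tree : ∀ (f : BoolFun 14) → G₂-Invariant f → f (λ _ → false) ≡ true → f (λ _ → true) ≡ false →
                  ∀ t → Computes t f → ¬ depth t < 14
no-shallow-tree f invariant f∅ f⊤ t computes shallow =
  unit-plus-seven (constant-words y) D (constant-words-unit y) (begin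
    constant-words y + + 7 * D                     ≡⟨ cong (λ z → z + + 7 * D) (sym constant-values) ⟩
    sumBlock (λ β → g (replicate 7 β)) + + 7 * D   ≡⟨ sym (orbit-decomposition 6 7 transversal constant-or-orbit g g-rotate) ⟩
    sumBlocks 7 g                                  ≡⟨ shallow-tree-sum 7 t shallow ⟩
    0ℤ                                             ∎)
  where
    open ≡-Reasoning
    g : Vec Block 7 → ℤ
    g v = signedValue t (flatten v)
    D : ℤ
    D = sumBlocks 7 (λ v → g v * transversal v)
    y : Bool
    y = eval t (input (replicate 7 (false , true)))
    value : ∀ v x → (∀ j → input v j ≡ x j) → eval t (input v) ≡ f x
    value v x same = trans (eval-ext t same) (computes x)
    -- invariance under a⁻¹ makes g rotation-invariant
    g-rotate : ∀ v → g (rotate v) ≡ g v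
    g-rotate v = cong₂ _*_ (sign-rotate v) (cong bit (begin
      eval t (input (rotate v))   ≡⟨ value (rotate v) _ (a⁻¹-rotates v) ⟩
      f (act (a⁻¹· ε) (input v))  ≡⟨ invariant (a⁻¹· ε) (input v) ⟩
      f (input v)                 ≡⟨ sym (computes (input v)) ⟩
      eval t (input v)            ∎))
    -- invariance under b identifies the two mixed constant words
    swapped : eval t (input (replicate 7 (true , false))) ≡ y
    swapped = trans (value (replicate 7 (true , false)) _ b-swaps)
                    (trans (invariant (b· ε) (input (replicate 7 (false , true)))) (sym (computes _)))
    constant-values : sumBlock (λ β → g (replicate 7 β)) ≡ constant-words y
    constant-values =
      cong₂ _+_ (cong₂ _+_ (cong (λ z → 1ℤ * bit z) (trans (value (replicate 7 (false , false)) (λ _ → false) (pointwise refl)) f∅)) refl)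
                (cong₂ _+_ (cong (λ z → -1ℤ * bit z) swapped)
                           (cong (λ z → 1ℤ * bit z) (trans (value (replicate 7 (true , true)) (λ _ → true) (pointwise refl)) f⊤)))

lemma2 : (f : BoolFun 14) → NonTrivial f → MonotoneNonIncreasing f → G₂-Invariant f → Elusive f
lemma2 f nontrivial monotone invariant t computes =
  ℕP.≮⇒≥ (no-shallow-tree f invariant (empty-true f nontrivial monotone) (full-false f nontrivial monotone) t computes)
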